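{- Let $n\ge3$, let $H$ be a finite abelian group of order $2n^2+1$ and let $T\subseteq H$ satisfy $|T|=2n$, $T=T^{(-1)}$ and $T^2=2H-T^{(2)}+(2n-2)e$ in $\mathbb{Z}[H]$. Let $Y_i$ denote the set of elements of $H$ whose coefficient in the group ring product $TT^{(4)}$ equals $i$. Then $2|Y_1|+3|Y_2|+3|Y_3|+2|Y_4|\ge 4n^2+3n$.
   Context: $H$ is written multiplicatively with identity $e$. In the group ring $\mathbb{Z}[H]$ a subset $A$ is identified with $\sum_{g\in A}g$ (so $H$ is the sum of all elements), and $A^{(t)}=\sum a_g g^t$ for $A=\sum a_g g$. -}

module Defs where

open import Level using (0ℓ)
open import Data.Bool using (Bool; true; false; if_then_else_)
open import Data.Nat as ℕ using (ℕ; zero; suc)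
open import Data.Fin as Fin using (Fin)
import Data.Fin.Properties as FinP
open import Data.Integer as ℤ using (ℤ; +_; -[1+_])
import Data.Integer.Properties as ℤP
open import Algebra.Structures using (IsAbelianGroup)
open import Function.Bundles using (_↔_; Inverse)
open import Relation.Binary.PropositionalEquality using (_≡_; refl; sym; trans; cong)
open import Relation.Binary.Definitions using (DecidableEquality)
open import Relation.Nullary using (Dec; yes; no; ¬_)
open import Relation.Nullary.Decidable using (⌊_⌋)

∑Fin : ∀ {m} → (Fin m → ℤ) → ℤ
∑Fin {zero}  f = + 0
∑Fin {suc m} f = f Fin.zero ℤ.+ ∑Fin (λ i → f (Fin.suc i))

record FinAbGroup : Set₁ where
  infixl 7 _∙_
  field
    Carrier        : Set
    _∙_            : Carrier → Carrier → Carrier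
    e              : Carrier
    _⁻¹            : Carrier → Carrier
    isAbelianGroup : IsAbelianGroup _≡_ _∙_ e _⁻¹
    order          : ℕ
    enum           : Fin order ↔ Carrier

  open Inverse enum using (to; from; strictlyInverseˡ)

  _≟_ : DecidableEquality Carrier
  x ≟ y with from x FinP.≟ from y
  ... | yes p = yes (trans (sym (strictlyInverseˡ x))
                      (trans (cong to p) (strictlyInverseˡ y)))
  ... | no ¬p = no (λ x≡y → ¬p (cong from x≡y))

  ∑ : (Carrier → ℤ) → ℤ
  ∑ f = ∑Fin (λ i → f (to i))

  count : {P : Carrier → Set} → ((x : Carrier) → Dec (P x)) → ℤ
  count P? = ∑ (λ x → if ⌊ P? x ⌋ then + 1 else + 0)

  powℕ : Carrier → ℕ → Carrier
  powℕ g zero    = e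
  powℕ g (suc k) = g ∙ powℕ g k

  pow : Carrier → ℤ → Carrier
  pow g (+ k)      = powℕ g k
  pow g -[1+ k ]   = (powℕ g (suc k)) ⁻¹

  ℤ[H] : Set
  ℤ[H] = Carrier → ℤ

  ⟦_⟧ : (Carrier → Bool) → ℤ[H]
  ⟦ A ⟧ g = if A g then + 1 else + 0

  𝐇 : ℤ[H]
  𝐇 g = + 1

  𝐞 : ℤ[H]
  𝐞 g = if ⌊ g ≟ e ⌋ then + 1 else + 0

  infixl 6 _⊕_ _⊖_
  infixl 7 _⊛_ _·_
  _⊕_ : ℤ[H] → ℤ[H] → ℤ[H]
  (A ⊕ B) g = A g ℤ.+ B g

  _⊖_ : ℤ[H] → ℤ[H] → ℤ[H]
  (A ⊖ B) g = A g ℤ.- B g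

  _·_ : ℤ → ℤ[H] → ℤ[H]
  (k · A) g = k ℤ.* A g

  _⊛_ : ℤ[H] → ℤ[H] → ℤ[H]
  (A ⊛ B) g = ∑ (λ x → A x ℤ.* B (x ⁻¹ ∙ g))

  _⁽_⁾ : ℤ[H] → ℤ → ℤ[H]
  (A ⁽ t ⁾) g = ∑ (λ x → if ⌊ pow x t ≟ g ⌋ then A x else + 0)

  infix 4 _≐_
  _≐_ : ℤ[H] → ℤ[H] → Set
  A ≐ B = ∀ g → A g ≡ B g

{-# OPTIONS --safe #-}
-- Write t for the indicator function of T, A = T T and c = T T⁽⁴⁾. As |H| is odd,
-- squaring is an automorphism of H, with inverse √, so the hypothesis on T T reads
-- A(u) = 2 − t(√u) + (2n − 2)[u = e]. The coefficients of c sum to (2n)², and since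
-- T and T⁽⁴⁾ are symmetric, Σ_g c(g)² = Σ_z A(z⁴) A(z). Inserting the formula for
-- A(z⁴) and bounding Σ_z t(z²) A(z) ≥ Σ_z (2 t(z²) − t(√z)) = 2n, valid as t is
-- 0/1-valued, gives Σ c² ≤ 3(2n)² − 3(2n), hence Σ (5c − c²) ≥ 2(4n² + 3n).
-- Finally 5i − i² ≤ 2(2[i=1] + 3[i=2] + 3[i=3] + 2[i=4]) for every natural number i.
module Submission where

open import Defs
open import Data.Bool using (Bool; true; false; if_then_else_)
import Data.Bool.Properties as BoolP
open import Data.Nat as ℕ using (ℕ; _≥_; zero; suc)
import Data.Nat.Properties as ℕP
import Data.Nat.Tactic.RingSolver as ℕRing
open import Data.Fin as Fin using (Fin)
import Data.Fin.Properties as FinP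
open import Data.Fin.Permutation using (Permutation; permutation)
open import Data.Integer as ℤ using (ℤ; +_; -[1+_])
import Data.Integer.Properties as ℤP
open import Data.Integer.Tactic.RingSolver using (solve-∀)
open import Data.Empty using (⊥-elim)
open import Function.Base using (_∘_)
open import Function.Bundles using (Inverse)
open import Level using (0ℓ)
open import Algebra.Bundles using (AbelianGroup)
import Algebra.Properties.AbelianGroup as AbelianGroupProperties
import Algebra.Properties.CommutativeSemigroup as CommutativeSemigroupProperties
import Algebra.Properties.CommutativeMonoid.Sum as CommutativeMonoidSum
import Algebra.Properties.Semiring.Sum as SemiringSum
open import Relation.Binary.PropositionalEquality
open import Relation.Nullary using (Dec; yes; no; ¬_)
open import Relation.Nullary.Decidable using (⌊_⌋; True; toWitness)

module ℤΣ = SemiringSum ℤP.+-*-semiring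

∑Fin≡sum : ∀ {m} (f : Fin m → ℤ) → ∑Fin f ≡ ℤΣ.sum f
∑Fin≡sum {zero}  f = refl
∑Fin≡sum {suc m} f = cong (λ s → f Fin.zero ℤ.+ s) (∑Fin≡sum (f ∘ Fin.suc))

∑Fin-mono : ∀ {m} {f g : Fin m → ℤ} → (∀ i → f i ℤ.≤ g i) → ∑Fin f ℤ.≤ ∑Fin g
∑Fin-mono {zero}  f≤g = ℤP.≤-refl
∑Fin-mono {suc m} f≤g = ℤP.+-mono-≤ (f≤g Fin.zero) (∑Fin-mono (f≤g ∘ Fin.suc))

∑Fin-point : ∀ {m} (f : Fin m → ℤ) (j : Fin m) → (∀ i → i ≢ j → f i ≡ + 0) → ∑Fin f ≡ f j
∑Fin-point {suc m} f Fin.zero off =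
  trans (cong (λ s → f Fin.zero ℤ.+ s) rest≡0) (ℤP.+-identityʳ _)
  where
  rest≡0 : ∑Fin (f ∘ Fin.suc) ≡ + 0
  rest≡0 = trans (∑Fin≡sum (f ∘ Fin.suc))
                 (trans (ℤΣ.sum-cong-≗ (λ i → off (Fin.suc i) λ ())) (ℤΣ.sum-replicate-zero m))
∑Fin-point {suc m} f (Fin.suc j) off =
  trans (cong₂ ℤ._+_ (off Fin.zero λ ())
                     (∑Fin-point (f ∘ Fin.suc) j (λ i i≢j → off (Fin.suc i) (i≢j ∘ FinP.suc-injective))))
        (ℤP.+-identityˡ _)

if-dec-yes : ∀ {P : Set} (d : Dec P) {a b : ℤ} → P → (if ⌊ d ⌋ then a else b) ≡ a
if-dec-yes (yes _) p = refl
if-dec-yes (no ¬p) p = ⊥-elim (¬p p)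

if-dec-no : ∀ {P : Set} (d : Dec P) {a b : ℤ} → ¬ P → (if ⌊ d ⌋ then a else b) ≡ b
if-dec-no (yes p) ¬p = ⊥-elim (¬p p)
if-dec-no (no _)  ¬p = refl

bit : Bool → ℤ
bit b = if b then + 1 else + 0

0≤bit : ∀ b → + 0 ℤ.≤ bit b
0≤bit true  = ℤ.+≤+ ℕ.z≤n
0≤bit false = ℤ.+≤+ ℕ.z≤n

bit*bit≡bit : ∀ b → bit b ℤ.* bit b ≡ bit b
bit*bit≡bit true  = refl
bit*bit≡bit false = refl

0≤i*bit : ∀ {i} b → + 0 ℤ.≤ i → + 0 ℤ.≤ i ℤ.* bit b
0≤i*bit {i} true  0≤i = subst (+ 0 ℤ.≤_) (sym (ℤP.*-identityʳ i)) 0≤i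
0≤i*bit {i} false _   = ℤP.≤-reflexive (sym (ℤP.*-zeroʳ i))

2a-b≤a*[2-b+x] : ∀ a b x → + 0 ℤ.≤ b → + 0 ℤ.≤ x →
                 + 2 ℤ.* bit a ℤ.- b ℤ.≤ bit a ℤ.* (+ 2 ℤ.- b ℤ.+ x)
2a-b≤a*[2-b+x] true  b x _ 0≤x =
  subst (+ 2 ℤ.- b ℤ.≤_) (sym (ℤP.*-identityˡ _)) (ℤP.i≤i+j (+ 2 ℤ.- b) x {{ℤ.nonNegative 0≤x}})
2a-b≤a*[2-b+x] false b x 0≤b _ =
  subst₂ ℤ._≤_ (sym (ℤP.+-identityˡ (ℤ.- b))) (sym (ℤP.*-zeroˡ (+ 2 ℤ.- b ℤ.+ x)))
               (ℤP.neg-mono-≤ 0≤b)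

by-decision : ∀ {x y : ℤ} {x≤y : True (x ℤP.≤? y)} → x ℤ.≤ y
by-decision {x≤y = x≤y} = toWitness x≤y

δ : ℤ → ℕ → ℤ
δ z i = if ⌊ z ℤ.≟ + i ⌋ then + 1 else + 0

weight : ℤ → ℤ
weight z = + 2 ℤ.* δ z 1 ℤ.+ + 3 ℤ.* δ z 2 ℤ.+ + 3 ℤ.* δ z 3 ℤ.+ + 2 ℤ.* δ z 4

5i-i²≤2weight : ∀ i → + 0 ℤ.≤ i → + 5 ℤ.* i ℤ.- i ℤ.* i ℤ.≤ + 2 ℤ.* weight i
5i-i²≤2weight (+ 0) _ = by-decision
5i-i²≤2weight (+ 1) _ = by-decision
5i-i²≤2weight (+ 2) _ = by-decision
5i-i²≤2weight (+ 3) _ = by-decision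
5i-i²≤2weight (+ 4) _ = by-decision
5i-i²≤2weight (+ suc (suc (suc (suc (suc j))))) _ =
  subst (ℤ._≤ + 0) (sym (negated (+ j)))
        (ℤP.neg-mono-≤ (subst (+ 0 ℤ.≤_) (ℤP.pos-* (5 ℕ.+ j) j) (ℤ.+≤+ ℕ.z≤n)))
  where
  negated : ∀ J → + 5 ℤ.* (+ 5 ℤ.+ J) ℤ.- (+ 5 ℤ.+ J) ℤ.* (+ 5 ℤ.+ J) ≡
                  ℤ.- ((+ 5 ℤ.+ J) ℤ.* J)
  negated = solve-∀
5i-i²≤2weight -[1+ _ ] ()

module Summation (G : FinAbGroup) where
  open FinAbGroup G
  open Inverse enum using (to; from; strictlyInverseˡ; strictlyInverseʳ)

  ∑≡sum : (f : Carrier → ℤ) → ∑ f ≡ ℤΣ.sum (f ∘ to)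
  ∑≡sum f = ∑Fin≡sum (f ∘ to)

  ∑-cong : {f g : Carrier → ℤ} → (∀ x → f x ≡ g x) → ∑ f ≡ ∑ g
  ∑-cong {f} {g} f≗g = trans (∑≡sum f) (trans (ℤΣ.sum-cong-≗ (f≗g ∘ to)) (sym (∑≡sum g)))

  ∑-distrib-+ : (f g : Carrier → ℤ) → ∑ (λ x → f x ℤ.+ g x) ≡ ∑ f ℤ.+ ∑ g
  ∑-distrib-+ f g = trans (∑≡sum (λ x → f x ℤ.+ g x))
    (trans (ℤΣ.∑-distrib-+ (f ∘ to) (g ∘ to)) (sym (cong₂ ℤ._+_ (∑≡sum f) (∑≡sum g))))

  *-distribˡ-∑ : (a : ℤ) (f : Carrier → ℤ) → a ℤ.* ∑ f ≡ ∑ (λ x → a ℤ.* f x)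
  *-distribˡ-∑ a f = trans (cong (a ℤ.*_) (∑≡sum f))
    (trans (ℤΣ.*-distribˡ-sum a (f ∘ to)) (sym (∑≡sum (λ x → a ℤ.* f x))))

  *-distribʳ-∑ : (a : ℤ) (f : Carrier → ℤ) → ∑ f ℤ.* a ≡ ∑ (λ x → f x ℤ.* a)
  *-distribʳ-∑ a f = trans (cong (ℤ._* a) (∑≡sum f))
    (trans (ℤΣ.*-distribʳ-sum a (f ∘ to)) (sym (∑≡sum (λ x → f x ℤ.* a))))

  ∑-distrib-- : (f g : Carrier → ℤ) → ∑ (λ x → f x ℤ.- g x) ≡ ∑ f ℤ.- ∑ g
  ∑-distrib-- f g = trans (∑-distrib-+ f (λ x → ℤ.- g x)) (cong (λ s → ∑ f ℤ.+ s) ∑-neg)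
    where
    ∑-neg : ∑ (λ x → ℤ.- g x) ≡ ℤ.- ∑ g
    ∑-neg = trans (∑-cong (λ x → sym (ℤP.-1*i≡-i (g x))))
                  (trans (sym (*-distribˡ-∑ (ℤ.- + 1) g)) (ℤP.-1*i≡-i (∑ g)))

  ∑-linear : (a b : ℤ) (f g h : Carrier → ℤ) →
    ∑ (λ x → a ℤ.* f x ℤ.+ b ℤ.* g x ℤ.- h x) ≡ a ℤ.* ∑ f ℤ.+ b ℤ.* ∑ g ℤ.- ∑ h
  ∑-linear a b f g h = trans (∑-distrib-- (λ x → a ℤ.* f x ℤ.+ b ℤ.* g x) h)
    (cong (ℤ._- ∑ h) (trans (∑-distrib-+ (λ x → a ℤ.* f x) (λ x → b ℤ.* g x))
                             (sym (cong₂ ℤ._+_ (*-distribˡ-∑ a f) (*-distribˡ-∑ b g)))))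

  ∑-mono : {f g : Carrier → ℤ} → (∀ x → f x ℤ.≤ g x) → ∑ f ℤ.≤ ∑ g
  ∑-mono f≤g = ∑Fin-mono (f≤g ∘ to)

  ∑-nonneg : {f : Carrier → ℤ} → (∀ x → + 0 ℤ.≤ f x) → + 0 ℤ.≤ ∑ f
  ∑-nonneg {f} 0≤f = subst (ℤ._≤ ∑ f) ∑0≡0 (∑-mono 0≤f)
    where
    ∑0≡0 : ∑ (λ _ → + 0) ≡ + 0
    ∑0≡0 = trans (∑≡sum (λ _ → + 0)) (ℤΣ.sum-replicate-zero order)

  ∑-product : (f g : Carrier → ℤ) → ∑ f ℤ.* ∑ g ≡ ∑ (λ x → ∑ (λ y → f x ℤ.* g y))
  ∑-product f g = trans (*-distribʳ-∑ (∑ g) f) (∑-cong (λ x → *-distribˡ-∑ (f x) g))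

  ∑-comm : (f : Carrier → Carrier → ℤ) → ∑ (λ x → ∑ (f x)) ≡ ∑ (λ y → ∑ (λ x → f x y))
  ∑-comm f = trans (∑∑≡sumsum f)
    (trans (ℤΣ.∑-comm (λ i j → f (to i) (to j))) (sym (∑∑≡sumsum (λ y x → f x y))))
    where
    ∑∑≡sumsum : (h : Carrier → Carrier → ℤ) →
                ∑ (λ x → ∑ (h x)) ≡ ℤΣ.sum (λ i → ℤΣ.sum (λ j → h (to i) (to j)))
    ∑∑≡sumsum h = trans (∑≡sum (λ x → ∑ (h x))) (ℤΣ.sum-cong-≗ (λ i → ∑≡sum (h (to i))))

  enum-permutation : (φ ψ : Carrier → Carrier) → (∀ y → φ (ψ y) ≡ y) → (∀ x → ψ (φ x) ≡ x) →
                     Permutation order order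
  enum-permutation φ ψ φψ ψφ =
    permutation (conj φ) (conj ψ) (conj-inverse φ ψ φψ) (conj-inverse ψ φ ψφ)
    where
    conj : (Carrier → Carrier) → Fin order → Fin order
    conj χ = from ∘ χ ∘ to
    conj-inverse : ∀ χ ω → (∀ y → χ (ω y) ≡ y) → ∀ i → conj χ (conj ω i) ≡ i
    conj-inverse χ ω χω i = trans (cong (from ∘ χ) (strictlyInverseˡ (ω (to i))))
                                  (trans (cong from (χω (to i))) (strictlyInverseʳ i))

  ∑-reindex : (f : Carrier → ℤ) (φ ψ : Carrier → Carrier) →
              (∀ y → φ (ψ y) ≡ y) → (∀ x → ψ (φ x) ≡ x) → ∑ f ≡ ∑ (f ∘ φ)
  ∑-reindex f φ ψ φψ ψφ = trans (∑≡sum f)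
    (trans (ℤΣ.∑-permute (f ∘ to) (enum-permutation φ ψ φψ ψφ))
           (trans (ℤΣ.sum-cong-≗ (λ i → cong f (strictlyInverseˡ (φ (to i)))))
                  (sym (∑≡sum (f ∘ φ)))))

  ∑-point : (f : Carrier → ℤ) (a : Carrier) → (∀ x → x ≢ a → f x ≡ + 0) → ∑ f ≡ f a
  ∑-point f a off = trans (∑Fin-point (f ∘ to) (from a) off′) (cong f (strictlyInverseˡ a))
    where
    off′ : ∀ i → i ≢ from a → f (to i) ≡ + 0
    off′ i i≢ = off (to i) (λ eq → i≢ (trans (sym (strictlyInverseʳ i)) (cong from eq)))

  count-≟true : (T : Carrier → Bool) → count (λ x → T x BoolP.≟ true) ≡ ∑ (bit ∘ T)
  count-≟true T = ∑-cong (λ x → if-≟true (T x))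
    where
    if-≟true : ∀ b → (if ⌊ b BoolP.≟ true ⌋ then + 1 else + 0) ≡ bit b
    if-≟true true  = refl
    if-≟true false = refl

  ∑-weight : (f : Carrier → ℤ) → ∑ (weight ∘ f) ≡
    + 2 ℤ.* count (λ x → f x ℤ.≟ + 1) ℤ.+ + 3 ℤ.* count (λ x → f x ℤ.≟ + 2)
      ℤ.+ + 3 ℤ.* count (λ x → f x ℤ.≟ + 3) ℤ.+ + 2 ℤ.* count (λ x → f x ℤ.≟ + 4)
  ∑-weight f =
    trans (∑-distrib-+ (λ x → w 2 1 x ℤ.+ w 3 2 x ℤ.+ w 3 3 x) (w 2 4)) (cong₂ ℤ._+_
      (trans (∑-distrib-+ (λ x → w 2 1 x ℤ.+ w 3 2 x) (w 3 3)) (cong₂ ℤ._+_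
        (trans (∑-distrib-+ (w 2 1) (w 3 2)) (cong₂ ℤ._+_ (term 2 1) (term 3 2)))
        (term 3 3)))
      (term 2 4))
    where
    w : ℕ → ℕ → Carrier → ℤ
    w a i x = + a ℤ.* δ (f x) i
    term : ∀ a i → ∑ (w a i) ≡ + a ℤ.* ∑ (λ x → δ (f x) i)
    term a i = sym (*-distribˡ-∑ (+ a) (λ x → δ (f x) i))

module GroupProperties (G : FinAbGroup) where
  open FinAbGroup G
  open Inverse enum using (to; strictlyInverseˡ)
  open Summation G using (enum-permutation)

  abelianGroup : AbelianGroup 0ℓ 0ℓ
  abelianGroup = record { Carrier = Carrier; _≈_ = _≡_; _∙_ = _∙_; ε = e; _⁻¹ = _⁻¹
                        ; isAbelianGroup = isAbelianGroup }

  open AbelianGroup abelianGroup public using (assoc; comm; identityˡ; identityʳ)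
  open AbelianGroupProperties abelianGroup public
    using (⁻¹-involutive; ⁻¹-∙-comm; ε⁻¹≈ε; identityˡ-unique; \\-leftDividesˡ; \\-leftDividesʳ)
  open CommutativeSemigroupProperties (AbelianGroup.commutativeSemigroup abelianGroup) using (interchange)

  powℕ-+ : ∀ x a b → powℕ x (a ℕ.+ b) ≡ powℕ x a ∙ powℕ x b
  powℕ-+ x zero    b = sym (identityˡ _)
  powℕ-+ x (suc a) b = trans (cong (x ∙_) (powℕ-+ x a b)) (sym (assoc x _ _))

  powℕ-∙ : ∀ x y a → powℕ (x ∙ y) a ≡ powℕ x a ∙ powℕ y a
  powℕ-∙ x y zero    = sym (identityˡ e)
  powℕ-∙ x y (suc a) = trans (cong ((x ∙ y) ∙_) (powℕ-∙ x y a)) (interchange x y _ _)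

  powℕ-⁻¹ : ∀ x a → powℕ (x ⁻¹) a ≡ powℕ x a ⁻¹
  powℕ-⁻¹ x zero    = sym ε⁻¹≈ε
  powℕ-⁻¹ x (suc a) = trans (cong (x ⁻¹ ∙_) (powℕ-⁻¹ x a)) (⁻¹-∙-comm x (powℕ x a))

  module ∏ = CommutativeMonoidSum (AbelianGroup.commutativeMonoid abelianGroup)

  ∏-const : ∀ m x → ∏.sum {m} (λ _ → x) ≡ powℕ x m
  ∏-const zero    x = refl
  ∏-const (suc m) x = cong (x ∙_) (∏-const m x)

  lagrange : ∀ x → powℕ x order ≡ e
  lagrange x = identityˡ-unique (powℕ x order) ∏H (sym ∏H≡xᵐ∏H)
    where
    open ≡-Reasoning
    ∏H : Carrier
    ∏H = ∏.sum to
    ∏H≡xᵐ∏H : ∏H ≡ powℕ x order ∙ ∏H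
    ∏H≡xᵐ∏H = begin
      ∏H                                  ≡⟨ ∏.∑-permute to (enum-permutation (x ∙_) (x ⁻¹ ∙_)
                                                 (\\-leftDividesˡ x) (\\-leftDividesʳ x)) ⟩
      ∏.sum (λ i → to (Inverse.from enum (x ∙ to i)))
                                          ≡⟨ ∏.sum-cong-≗ (λ i → strictlyInverseˡ (x ∙ to i)) ⟩
      ∏.sum (λ i → x ∙ to i)              ≡⟨ ∏.∑-distrib-+ (λ _ → x) to ⟩
      ∏.sum {order} (λ _ → x) ∙ ∏H        ≡⟨ cong (_∙ ∏H) (∏-const order x) ⟩
      powℕ x order ∙ ∏H                   ∎

  _² : Carrier → Carrier
  x ² = x ∙ x

  _⁴ : Carrier → Carrier
  x ⁴ = x ² ²

  pow-[-1] : ∀ x → pow x -[1+ 0 ] ≡ x ⁻¹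
  pow-[-1] x = cong _⁻¹ (identityʳ x)

  pow-2 : ∀ x → pow x (+ 2) ≡ x ²
  pow-2 x = cong (x ∙_) (identityʳ x)

  pow-4 : ∀ x → pow x (+ 4) ≡ x ⁴
  pow-4 x = trans (powℕ-+ x 2 2) (cong₂ _∙_ (pow-2 x) (pow-2 x))

module OddOrder (G : FinAbGroup) {k : ℕ} (odd : FinAbGroup.order G ≡ 2 ℕ.* k ℕ.+ 1) where
  open FinAbGroup G
  open GroupProperties G

  √_ : Carrier → Carrier
  √ y = powℕ y (suc k)

  ∜_ : Carrier → Carrier
  ∜ y = √ √ y

  ²-√ : ∀ y → (√ y) ² ≡ y
  ²-√ y = begin
    √ y ∙ √ y                 ≡⟨ powℕ-+ y (suc k) (suc k) ⟨
    powℕ y (suc k ℕ.+ suc k)  ≡⟨ cong (powℕ y) (trans ([1+k]+[1+k]≡1+[2k+1] k) (cong suc (sym odd))) ⟩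
    y ∙ powℕ y order          ≡⟨ cong (y ∙_) (lagrange y) ⟩
    y ∙ e                     ≡⟨ identityʳ y ⟩
    y                         ∎
    where
    open ≡-Reasoning
    [1+k]+[1+k]≡1+[2k+1] : ∀ k → suc k ℕ.+ suc k ≡ suc (2 ℕ.* k ℕ.+ 1)
    [1+k]+[1+k]≡1+[2k+1] = ℕRing.solve-∀

  √-² : ∀ x → √ (x ²) ≡ x
  √-² x = trans (powℕ-∙ x x (suc k)) (²-√ x)

  ∜-⁴ : ∀ x → ∜ (x ⁴) ≡ x
  ∜-⁴ x = trans (cong √_ (√-² (x ²))) (√-² x)

  ⁴-∜ : ∀ y → (∜ y) ⁴ ≡ y
  ⁴-∜ y = trans (cong _² (²-√ (√ y))) (²-√ y)

  ⁴-injective : ∀ {x y} → x ⁴ ≡ y ⁴ → x ≡ y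
  ⁴-injective {x} {y} eq = trans (sym (∜-⁴ x)) (trans (cong ∜_ eq) (∜-⁴ y))

  e⁴≡e : e ⁴ ≡ e
  e⁴≡e = trans (cong _² (identityˡ e)) (identityˡ e)

  ∜-∙ : ∀ x y → ∜ (x ∙ y) ≡ ∜ x ∙ ∜ y
  ∜-∙ x y = trans (cong √_ (powℕ-∙ x y (suc k))) (powℕ-∙ (√ x) (√ y) (suc k))

  ∜-⁻¹ : ∀ x → ∜ (x ⁻¹) ≡ (∜ x) ⁻¹
  ∜-⁻¹ x = trans (cong √_ (powℕ-⁻¹ x (suc k))) (powℕ-⁻¹ (√ x) (suc k))

module GroupRing (G : FinAbGroup) where
  open FinAbGroup G
  open Summation G
  open GroupProperties G

  IsSymmetric : ℤ[H] → Set
  IsSymmetric X = ∀ x → X (x ⁻¹) ≡ X x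

  ⁽⁾-coeff : (X : ℤ[H]) (s : ℤ) (φ ψ : Carrier → Carrier) → (∀ x → pow x s ≡ φ x) →
             (∀ y → φ (ψ y) ≡ y) → (∀ x → ψ (φ x) ≡ x) → X ⁽ s ⁾ ≐ X ∘ ψ
  ⁽⁾-coeff X s φ ψ pow≡φ φψ ψφ g =
    trans (∑-point _ (ψ g) off) (if-dec-yes (pow (ψ g) s ≟ g) (trans (pow≡φ (ψ g)) (φψ g)))
    where
    off : ∀ x → x ≢ ψ g → (if ⌊ pow x s ≟ g ⌋ then X x else + 0) ≡ + 0
    off x x≢ψg = if-dec-no (pow x s ≟ g)
                   (λ eq → x≢ψg (trans (sym (ψφ x)) (cong ψ (trans (sym (pow≡φ x)) eq))))

  𝐞-∘-injective : (φ : Carrier → Carrier) → φ e ≡ e → (∀ {x y} → φ x ≡ φ y → x ≡ y) →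
                  ∀ x → 𝐞 (φ x) ≡ 𝐞 x
  𝐞-∘-injective φ φe≡e φ-injective x = by-cases (x ≟ e)
    where
    by-cases : Dec (x ≡ e) → 𝐞 (φ x) ≡ 𝐞 x
    by-cases (yes x≡e) = trans (if-dec-yes (φ x ≟ e) (trans (cong φ x≡e) φe≡e))
                               (sym (if-dec-yes (x ≟ e) x≡e))
    by-cases (no x≢e)  = trans (if-dec-no (φ x ≟ e) (λ eq → x≢e (φ-injective (trans eq (sym φe≡e)))))
                               (sym (if-dec-no (x ≟ e) x≢e))

  ∑-𝐞* : (f : ℤ[H]) → ∑ (λ z → 𝐞 z ℤ.* f z) ≡ f e
  ∑-𝐞* f = trans (∑-point _ e off)
    (trans (cong (ℤ._* f e) (if-dec-yes (e ≟ e) refl)) (ℤP.*-identityˡ (f e)))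
    where
    off : ∀ z → z ≢ e → 𝐞 z ℤ.* f z ≡ + 0
    off z z≢e = trans (cong (ℤ._* f z) (if-dec-no (z ≟ e) z≢e)) (ℤP.*-zeroˡ (f z))

  ⊛-congʳ : (X : ℤ[H]) {Y Z : ℤ[H]} → Y ≐ Z → X ⊛ Y ≐ X ⊛ Z
  ⊛-congʳ X Y≐Z g = ∑-cong (λ x → cong (X x ℤ.*_) (Y≐Z (x ⁻¹ ∙ g)))

  ∑-translate : (a : Carrier) (f : Carrier → ℤ) → ∑ f ≡ ∑ (λ u → f (a ∙ u))
  ∑-translate a f = ∑-reindex f (a ∙_) (a ⁻¹ ∙_) (\\-leftDividesˡ a) (\\-leftDividesʳ a)

  ∑-⊛ : (X Y : ℤ[H]) → ∑ (X ⊛ Y) ≡ ∑ X ℤ.* ∑ Y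
  ∑-⊛ X Y = begin
    ∑ (λ g → ∑ (λ x → X x ℤ.* Y (x ⁻¹ ∙ g)))
      ≡⟨ ∑-comm (λ g x → X x ℤ.* Y (x ⁻¹ ∙ g)) ⟩
    ∑ (λ x → ∑ (λ g → X x ℤ.* Y (x ⁻¹ ∙ g)))
      ≡⟨ ∑-cong (λ x → *-distribˡ-∑ (X x) (λ g → Y (x ⁻¹ ∙ g))) ⟨
    ∑ (λ x → X x ℤ.* ∑ (λ g → Y (x ⁻¹ ∙ g)))
      ≡⟨ ∑-cong (λ x → cong (X x ℤ.*_) (∑-translate (x ⁻¹) Y)) ⟨
    ∑ (λ x → X x ℤ.* ∑ Y)
      ≡⟨ *-distribʳ-∑ (∑ Y) X ⟨
    ∑ X ℤ.* ∑ Y ∎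
    where open ≡-Reasoning

  autocorrelation : (X : ℤ[H]) → IsSymmetric X → ∀ w → (X ⊛ X) w ≡ ∑ (λ u → X u ℤ.* X (u ∙ w))
  autocorrelation X X-sym w =
    trans (∑-reindex (λ x → X x ℤ.* X (x ⁻¹ ∙ w)) _⁻¹ _⁻¹ ⁻¹-involutive ⁻¹-involutive)
          (∑-cong (λ u → cong₂ ℤ._*_ (X-sym u) (cong (λ v → X (v ∙ w)) (⁻¹-involutive u))))

  correlation : (Y : ℤ[H]) → IsSymmetric Y →
                ∀ a b → ∑ (λ g → Y (a ⁻¹ ∙ g) ℤ.* Y (b ⁻¹ ∙ g)) ≡ (Y ⊛ Y) (b ⁻¹ ∙ a)
  correlation Y Y-sym a b = begin
    ∑ (λ g → Y (a ⁻¹ ∙ g) ℤ.* Y (b ⁻¹ ∙ g))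
      ≡⟨ ∑-translate a (λ g → Y (a ⁻¹ ∙ g) ℤ.* Y (b ⁻¹ ∙ g)) ⟩
    ∑ (λ u → Y (a ⁻¹ ∙ (a ∙ u)) ℤ.* Y (b ⁻¹ ∙ (a ∙ u)))
      ≡⟨ ∑-cong (λ u → cong₂ ℤ._*_ (cong Y (\\-leftDividesʳ a u))
                                    (cong Y (trans (sym (assoc _ _ u)) (comm _ u)))) ⟩
    ∑ (λ u → Y u ℤ.* Y (u ∙ (b ⁻¹ ∙ a)))
      ≡⟨ autocorrelation Y Y-sym (b ⁻¹ ∙ a) ⟨
    (Y ⊛ Y) (b ⁻¹ ∙ a) ∎
    where open ≡-Reasoning

  ∑∑-difference : (X F : ℤ[H]) → IsSymmetric X →
    ∑ (λ x → ∑ (λ y → X x ℤ.* X y ℤ.* F (y ⁻¹ ∙ x))) ≡ ∑ (λ z → (X ⊛ X) z ℤ.* F z)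
  ∑∑-difference X F X-sym = begin
    ∑ (λ x → ∑ (λ y → X x ℤ.* X y ℤ.* F (y ⁻¹ ∙ x)))
      ≡⟨ ∑-comm (λ x y → X x ℤ.* X y ℤ.* F (y ⁻¹ ∙ x)) ⟩
    ∑ (λ y → ∑ (λ x → X x ℤ.* X y ℤ.* F (y ⁻¹ ∙ x)))
      ≡⟨ ∑-cong (λ y → ∑-translate y (λ x → X x ℤ.* X y ℤ.* F (y ⁻¹ ∙ x))) ⟩
    ∑ (λ y → ∑ (λ z → X (y ∙ z) ℤ.* X y ℤ.* F (y ⁻¹ ∙ (y ∙ z))))
      ≡⟨ ∑-cong (λ y → ∑-cong (λ z → cong₂ ℤ._*_ (ℤP.*-comm (X (y ∙ z)) (X y))
                                                  (cong F (\\-leftDividesʳ y z)))) ⟩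
    ∑ (λ y → ∑ (λ z → X y ℤ.* X (y ∙ z) ℤ.* F z))
      ≡⟨ ∑-comm (λ y z → X y ℤ.* X (y ∙ z) ℤ.* F z) ⟩
    ∑ (λ z → ∑ (λ y → X y ℤ.* X (y ∙ z) ℤ.* F z))
      ≡⟨ ∑-cong (λ z → *-distribʳ-∑ (F z) (λ y → X y ℤ.* X (y ∙ z))) ⟨
    ∑ (λ z → ∑ (λ y → X y ℤ.* X (y ∙ z)) ℤ.* F z)
      ≡⟨ ∑-cong (λ z → cong (ℤ._* F z) (autocorrelation X X-sym z)) ⟨
    ∑ (λ z → (X ⊛ X) z ℤ.* F z) ∎
    where open ≡-Reasoning

  ∑-⊛² : (X Y : ℤ[H]) → IsSymmetric X → IsSymmetric Y →
         ∑ (λ g → (X ⊛ Y) g ℤ.* (X ⊛ Y) g) ≡ ∑ (λ z → (X ⊛ X) z ℤ.* (Y ⊛ Y) z)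
  ∑-⊛² X Y X-sym Y-sym = begin
    ∑ (λ g → (X ⊛ Y) g ℤ.* (X ⊛ Y) g)
      ≡⟨ ∑-cong (λ g → ∑-product (λ x → term x g) (λ y → term y g)) ⟩
    ∑ (λ g → ∑ (λ x → ∑ (λ y → term x g ℤ.* term y g)))
      ≡⟨ ∑-comm (λ g x → ∑ (λ y → term x g ℤ.* term y g)) ⟩
    ∑ (λ x → ∑ (λ g → ∑ (λ y → term x g ℤ.* term y g)))
      ≡⟨ ∑-cong (λ x → ∑-comm (λ g y → term x g ℤ.* term y g)) ⟩
    ∑ (λ x → ∑ (λ y → ∑ (λ g → term x g ℤ.* term y g)))
      ≡⟨ ∑-cong (λ x → ∑-cong (λ y → ∑-over-g x y)) ⟩
    ∑ (λ x → ∑ (λ y → X x ℤ.* X y ℤ.* (Y ⊛ Y) (y ⁻¹ ∙ x)))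
      ≡⟨ ∑∑-difference X (Y ⊛ Y) X-sym ⟩
    ∑ (λ z → (X ⊛ X) z ℤ.* (Y ⊛ Y) z) ∎
    where
    open ≡-Reasoning
    term : Carrier → Carrier → ℤ
    term x g = X x ℤ.* Y (x ⁻¹ ∙ g)
    interchange-* : ∀ a b c d → a ℤ.* b ℤ.* (c ℤ.* d) ≡ a ℤ.* c ℤ.* (b ℤ.* d)
    interchange-* = solve-∀
    ∑-over-g : ∀ x y → ∑ (λ g → term x g ℤ.* term y g) ≡ X x ℤ.* X y ℤ.* (Y ⊛ Y) (y ⁻¹ ∙ x)
    ∑-over-g x y =
      trans (∑-cong (λ g → interchange-* (X x) (Y (x ⁻¹ ∙ g)) (X y) (Y (y ⁻¹ ∙ g))))
            (trans (sym (*-distribˡ-∑ (X x ℤ.* X y) (λ g → Y (x ⁻¹ ∙ g) ℤ.* Y (y ⁻¹ ∙ g))))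
                   (cong (X x ℤ.* X y ℤ.*_) (correlation Y Y-sym x y)))

  ⊛-∘-automorphism : (X Y : ℤ[H]) (ψ φ : Carrier → Carrier) →
    (∀ x y → ψ (x ∙ y) ≡ ψ x ∙ ψ y) → (∀ x → ψ (x ⁻¹) ≡ ψ x ⁻¹) →
    (∀ y → ψ (φ y) ≡ y) → (∀ x → φ (ψ x) ≡ x) → (X ∘ ψ) ⊛ (Y ∘ ψ) ≐ (X ⊛ Y) ∘ ψ
  ⊛-∘-automorphism X Y ψ φ ψ-∙ ψ-⁻¹ ψφ φψ z = begin
    ∑ (λ x → X (ψ x) ℤ.* Y (ψ (x ⁻¹ ∙ z)))
      ≡⟨ ∑-cong (λ x → cong (λ v → X (ψ x) ℤ.* Y v)
                             (trans (ψ-∙ (x ⁻¹) z) (cong (_∙ ψ z) (ψ-⁻¹ x)))) ⟩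
    ∑ (λ x → X (ψ x) ℤ.* Y (ψ x ⁻¹ ∙ ψ z))
      ≡⟨ ∑-reindex (λ x → X (ψ x) ℤ.* Y (ψ x ⁻¹ ∙ ψ z)) φ ψ φψ ψφ ⟩
    ∑ (λ u → X (ψ (φ u)) ℤ.* Y (ψ (φ u) ⁻¹ ∙ ψ z))
      ≡⟨ ∑-cong (λ u → cong (λ v → X v ℤ.* Y (v ⁻¹ ∙ ψ z)) (ψφ u)) ⟩
    (X ⊛ Y) (ψ z) ∎
    where open ≡-Reasoning

module Bound (G : FinAbGroup) where
  open FinAbGroup G
  open Summation G
  open GroupProperties G
  open GroupRing G

  module _ {k : ℕ} (odd : order ≡ 2 ℕ.* k ℕ.+ 1) {N : ℤ} (2≤N : + 2 ℤ.≤ N) {T : Carrier → Bool}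
           (|T|≡N : ∑ ⟦ T ⟧ ≡ N) (T-sym : ⟦ T ⟧ ⁽ -[1+ 0 ] ⁾ ≐ ⟦ T ⟧)
           (T-square : ⟦ T ⟧ ⊛ ⟦ T ⟧ ≐ (+ 2 · 𝐇) ⊖ (⟦ T ⟧ ⁽ + 2 ⁾) ⊕ ((N ℤ.- + 2) · 𝐞))
           where
    open OddOrder G {k} odd

    t A c c² : ℤ[H]
    t = ⟦ T ⟧
    A = t ⊛ t
    c = t ⊛ (t ⁽ + 4 ⁾)
    c² g = c g ℤ.* c g

    D : ℤ
    D = N ℤ.- + 2

    0≤D : + 0 ℤ.≤ D
    0≤D = ℤP.i≤j⇒0≤j-i 2≤N

    t-symmetric : IsSymmetric t
    t-symmetric x =
      trans (sym (⁽⁾-coeff t -[1+ 0 ] _⁻¹ _⁻¹ pow-[-1] ⁻¹-involutive ⁻¹-involutive x)) (T-sym x)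

    t∜-symmetric : IsSymmetric (t ∘ ∜_)
    t∜-symmetric x = trans (cong t (∜-⁻¹ x)) (t-symmetric (∜ x))

    t⁽²⁾ : t ⁽ + 2 ⁾ ≐ t ∘ √_
    t⁽²⁾ = ⁽⁾-coeff t (+ 2) _² √_ pow-2 ²-√ √-²

    t⁽⁴⁾ : t ⁽ + 4 ⁾ ≐ t ∘ ∜_
    t⁽⁴⁾ = ⁽⁾-coeff t (+ 4) _⁴ ∜_ pow-4 ⁴-∜ ∜-⁴

    ∑t∘²≡N : ∑ (t ∘ _²) ≡ N
    ∑t∘²≡N = trans (sym (∑-reindex t _² √_ ²-√ √-²)) |T|≡N

    ∑t∘√≡N : ∑ (t ∘ √_) ≡ N
    ∑t∘√≡N = trans (sym (∑-reindex t √_ _² √-² ²-√)) |T|≡N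

    A-formula : ∀ u → A u ≡ + 2 ℤ.- t (√ u) ℤ.+ D ℤ.* 𝐞 u
    A-formula u = trans (T-square u) (cong (λ v → + 2 ℤ.- v ℤ.+ D ℤ.* 𝐞 u) (t⁽²⁾ u))

    A⁴-formula : ∀ w → A (w ⁴) ≡ + 2 ℤ.- t (w ²) ℤ.+ D ℤ.* 𝐞 w
    A⁴-formula w = trans (A-formula (w ⁴))
      (cong₂ (λ a b → + 2 ℤ.- t a ℤ.+ D ℤ.* b) (√-² (w ²)) (𝐞-∘-injective _⁴ e⁴≡e ⁴-injective w))

    ∑A≡N² : ∑ A ≡ N ℤ.* N
    ∑A≡N² = trans (∑-⊛ t t) (cong₂ ℤ._*_ |T|≡N |T|≡N)

    Ae≡N : A e ≡ N
    Ae≡N = trans (autocorrelation t t-symmetric e)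
      (trans (∑-cong (λ u → trans (cong (λ v → t u ℤ.* t v) (identityʳ u)) (bit*bit≡bit (T u)))) |T|≡N)

    c≐t⊛t∘∜ : c ≐ t ⊛ (t ∘ ∜_)
    c≐t⊛t∘∜ = ⊛-congʳ t t⁽⁴⁾

    0≤c : ∀ g → + 0 ℤ.≤ c g
    0≤c g = subst (+ 0 ℤ.≤_) (sym (c≐t⊛t∘∜ g))
                  (∑-nonneg (λ x → 0≤i*bit (T (∜ (x ⁻¹ ∙ g))) (0≤bit (T x))))

    ∑c≡N² : ∑ c ≡ N ℤ.* N
    ∑c≡N² = trans (∑-⊛ t (t ⁽ + 4 ⁾))
      (cong₂ ℤ._*_ |T|≡N (trans (∑-cong t⁽⁴⁾)
                                (trans (sym (∑-reindex t ∜_ _⁴ ∜-⁴ ⁴-∜)) |T|≡N)))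

    ∑c²≡∑A⁴A : ∑ c² ≡ ∑ (λ w → A (w ⁴) ℤ.* A w)
    ∑c²≡∑A⁴A = begin
      ∑ c²
        ≡⟨ ∑-cong (λ g → cong₂ ℤ._*_ (c≐t⊛t∘∜ g) (c≐t⊛t∘∜ g)) ⟩
      ∑ (λ g → (t ⊛ (t ∘ ∜_)) g ℤ.* (t ⊛ (t ∘ ∜_)) g)
        ≡⟨ ∑-⊛² t (t ∘ ∜_) t-symmetric t∜-symmetric ⟩
      ∑ (λ z → A z ℤ.* ((t ∘ ∜_) ⊛ (t ∘ ∜_)) z)
        ≡⟨ ∑-cong (λ z → cong (A z ℤ.*_)
                               (⊛-∘-automorphism t t ∜_ _⁴ ∜-∙ ∜-⁻¹ ∜-⁴ ⁴-∜ z)) ⟩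
      ∑ (λ z → A z ℤ.* A (∜ z))
        ≡⟨ ∑-reindex (λ z → A z ℤ.* A (∜ z)) _⁴ ∜_ ⁴-∜ ∜-⁴ ⟩
      ∑ (λ w → A (w ⁴) ℤ.* A (∜ (w ⁴)))
        ≡⟨ ∑-cong (λ w → cong (λ v → A (w ⁴) ℤ.* A v) (∜-⁴ w)) ⟩
      ∑ (λ w → A (w ⁴) ℤ.* A w) ∎
      where open ≡-Reasoning

    S : ℤ
    S = ∑ (λ z → t (z ²) ℤ.* A z)

    ∑c²≡2N²+DN-S : ∑ c² ≡ + 2 ℤ.* (N ℤ.* N) ℤ.+ D ℤ.* N ℤ.- S
    ∑c²≡2N²+DN-S = trans ∑c²≡∑A⁴A (trans (∑-cong expand)
      (trans (∑-linear (+ 2) D A (λ z → 𝐞 z ℤ.* A z) (λ z → t (z ²) ℤ.* A z))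
             (cong₂ (λ a b → + 2 ℤ.* a ℤ.+ D ℤ.* b ℤ.- S) ∑A≡N² (trans (∑-𝐞* A) Ae≡N))))
      where
      distrib : ∀ a b d x → (+ 2 ℤ.- a ℤ.+ d ℤ.* b) ℤ.* x ≡
                            + 2 ℤ.* x ℤ.+ d ℤ.* (b ℤ.* x) ℤ.- a ℤ.* x
      distrib = solve-∀
      expand : ∀ w → A (w ⁴) ℤ.* A w ≡
                     + 2 ℤ.* A w ℤ.+ D ℤ.* (𝐞 w ℤ.* A w) ℤ.- t (w ²) ℤ.* A w
      expand w = trans (cong (ℤ._* A w) (A⁴-formula w)) (distrib (t (w ²)) (𝐞 w) D (A w))

    N≤S : N ℤ.≤ S
    N≤S = begin
      N
        ≡⟨ N≡2N-N N ⟩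
      + 2 ℤ.* N ℤ.- N
        ≡⟨ cong₂ (λ a b → + 2 ℤ.* a ℤ.- b) ∑t∘²≡N ∑t∘√≡N ⟨
      + 2 ℤ.* ∑ (t ∘ _²) ℤ.- ∑ (t ∘ √_)
        ≡⟨ cong (ℤ._- ∑ (t ∘ √_)) (*-distribˡ-∑ (+ 2) (t ∘ _²)) ⟩
      ∑ (λ z → + 2 ℤ.* t (z ²)) ℤ.- ∑ (t ∘ √_)
        ≡⟨ ∑-distrib-- (λ z → + 2 ℤ.* t (z ²)) (t ∘ √_) ⟨
      ∑ (λ z → + 2 ℤ.* t (z ²) ℤ.- t (√ z))
        ≤⟨ ∑-mono pointwise ⟩
      S ∎
      where
      open ℤP.≤-Reasoning
      N≡2N-N : ∀ n → n ≡ + 2 ℤ.* n ℤ.- n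
      N≡2N-N = solve-∀
      pointwise : ∀ z → + 2 ℤ.* t (z ²) ℤ.- t (√ z) ℤ.≤ t (z ²) ℤ.* A z
      pointwise z = subst (+ 2 ℤ.* t (z ²) ℤ.- t (√ z) ℤ.≤_) (cong (t (z ²) ℤ.*_) (sym (A-formula z)))
        (2a-b≤a*[2-b+x] (T (z ²)) (t (√ z)) (D ℤ.* 𝐞 z)
                         (0≤bit (T (√ z))) (0≤i*bit ⌊ z ≟ e ⌋ 0≤D))

    ∑c²≤2N²+DN-N : ∑ c² ℤ.≤ + 2 ℤ.* (N ℤ.* N) ℤ.+ D ℤ.* N ℤ.- N
    ∑c²≤2N²+DN-N = subst (ℤ._≤ + 2 ℤ.* (N ℤ.* N) ℤ.+ D ℤ.* N ℤ.- N) (sym ∑c²≡2N²+DN-S)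
                 (ℤP.+-monoʳ-≤ (+ 2 ℤ.* (N ℤ.* N) ℤ.+ D ℤ.* N) (ℤP.neg-mono-≤ N≤S))

    weighted-count-bound : + 2 ℤ.* (N ℤ.* N) ℤ.+ + 3 ℤ.* N ℤ.≤ + 2 ℤ.* ∑ (weight ∘ c)
    weighted-count-bound = begin
      + 2 ℤ.* (N ℤ.* N) ℤ.+ + 3 ℤ.* N
        ≡⟨ rearrange N ⟩
      + 5 ℤ.* (N ℤ.* N) ℤ.- bound
        ≡⟨ cong (λ s → + 5 ℤ.* s ℤ.- bound) ∑c≡N² ⟨
      + 5 ℤ.* ∑ c ℤ.- bound
        ≤⟨ ℤP.+-monoʳ-≤ (+ 5 ℤ.* ∑ c) (ℤP.neg-mono-≤ ∑c²≤2N²+DN-N) ⟩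
      + 5 ℤ.* ∑ c ℤ.- ∑ c²
        ≡⟨ cong (ℤ._- ∑ c²) (*-distribˡ-∑ (+ 5) c) ⟩
      ∑ (λ g → + 5 ℤ.* c g) ℤ.- ∑ c²
        ≡⟨ ∑-distrib-- (λ g → + 5 ℤ.* c g) c² ⟨
      ∑ (λ g → + 5 ℤ.* c g ℤ.- c g ℤ.* c g)
        ≤⟨ ∑-mono (λ g → 5i-i²≤2weight (c g) (0≤c g)) ⟩
      ∑ (λ g → + 2 ℤ.* weight (c g))
        ≡⟨ *-distribˡ-∑ (+ 2) (weight ∘ c) ⟨
      + 2 ℤ.* ∑ (weight ∘ c) ∎
      where
      open ℤP.≤-Reasoning
      bound : ℤ
      bound = + 2 ℤ.* (N ℤ.* N) ℤ.+ D ℤ.* N ℤ.- N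
      rearrange : ∀ n → + 2 ℤ.* (n ℤ.* n) ℤ.+ + 3 ℤ.* n ≡
                        + 5 ℤ.* (n ℤ.* n) ℤ.- (+ 2 ℤ.* (n ℤ.* n) ℤ.+ (n ℤ.- + 2) ℤ.* n ℤ.- n)
      rearrange = solve-∀

doubled-target : ∀ n → + 2 ℤ.* + (4 ℕ.* (n ℕ.* n) ℕ.+ 3 ℕ.* n) ≡
                       + 2 ℤ.* (+ (2 ℕ.* n) ℤ.* + (2 ℕ.* n)) ℤ.+ + 3 ℤ.* + (2 ℕ.* n)
doubled-target n = begin
  + 2 ℤ.* + (4 ℕ.* (n ℕ.* n) ℕ.+ 3 ℕ.* n)   ≡⟨ ℤP.pos-* 2 (4 ℕ.* (n ℕ.* n) ℕ.+ 3 ℕ.* n) ⟨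
  + (2 ℕ.* (4 ℕ.* (n ℕ.* n) ℕ.+ 3 ℕ.* n))   ≡⟨ cong +_ (in-ℕ n) ⟩
  + (2 ℕ.* (m ℕ.* m) ℕ.+ 3 ℕ.* m)           ≡⟨ ℤP.pos-+ (2 ℕ.* (m ℕ.* m)) (3 ℕ.* m) ⟩
  + (2 ℕ.* (m ℕ.* m)) ℤ.+ + (3 ℕ.* m)       ≡⟨ cong₂ ℤ._+_ (trans (ℤP.pos-* 2 (m ℕ.* m))
                                                                  (cong (λ s → + 2 ℤ.* s) (ℤP.pos-* m m)))
                                                           (ℤP.pos-* 3 m) ⟩
  + 2 ℤ.* (+ m ℤ.* + m) ℤ.+ + 3 ℤ.* + m     ∎
  where
  open ≡-Reasoning
  m : ℕ
  m = 2 ℕ.* n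
  in-ℕ : ∀ n → 2 ℕ.* (4 ℕ.* (n ℕ.* n) ℕ.+ 3 ℕ.* n) ≡
               2 ℕ.* ((2 ℕ.* n) ℕ.* (2 ℕ.* n)) ℕ.+ 3 ℕ.* (2 ℕ.* n)
  in-ℕ = ℕRing.solve-∀

corollary1 : (n : ℕ) → n ≥ 3 → (G : FinAbGroup) →
    let open FinAbGroup G in
    order ≡ 2 ℕ.* (n ℕ.* n) ℕ.+ 1 →
    (T : Carrier → Bool) →
    count (λ g → T g BoolP.≟ true) ≡ + (2 ℕ.* n) →
    ⟦ T ⟧ ⁽ -[1+ 0 ] ⁾ ≐ ⟦ T ⟧ →
    ⟦ T ⟧ ⊛ ⟦ T ⟧ ≐ (+ 2 · 𝐇) ⊖ (⟦ T ⟧ ⁽ + 2 ⁾) ⊕ ((+ (2 ℕ.* n) ℤ.- + 2) · 𝐞) →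
    let Y : ℕ → ℤ
        Y i = count (λ g → (⟦ T ⟧ ⊛ (⟦ T ⟧ ⁽ + 4 ⁾)) g ℤ.≟ + i)
    in (+ 2) ℤ.* Y 1 ℤ.+ (+ 3) ℤ.* Y 2 ℤ.+ (+ 3) ℤ.* Y 3 ℤ.+ (+ 2) ℤ.* Y 4
         ℤ.≥ + (4 ℕ.* (n ℕ.* n) ℕ.+ 3 ℕ.* n)
corollary1 n n≥3 G |H|≡2n²+1 T |T|≡2n T-sym T-square =
  subst (target ℤ.≤_) (∑-weight c) (ℤP.*-cancelˡ-≤-pos target (∑ (weight ∘ c)) (+ 2) doubled)
  where
  open FinAbGroup G
  open Summation G
  target : ℤ
  target = + (4 ℕ.* (n ℕ.* n) ℕ.+ 3 ℕ.* n)
  c : ℤ[H]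
  c = ⟦ T ⟧ ⊛ (⟦ T ⟧ ⁽ + 4 ⁾)
  2≤2n : + 2 ℤ.≤ + (2 ℕ.* n)
  2≤2n = ℤ.+≤+ (ℕP.*-monoʳ-≤ 2 (ℕP.≤-trans (ℕ.s≤s ℕ.z≤n) n≥3))
  |T|≡2n′ : ∑ ⟦ T ⟧ ≡ + (2 ℕ.* n)
  |T|≡2n′ = trans (sym (count-≟true T)) |T|≡2n
  doubled : + 2 ℤ.* target ℤ.≤ + 2 ℤ.* ∑ (weight ∘ c)
  doubled = subst (ℤ._≤ + 2 ℤ.* ∑ (weight ∘ c)) (sym (doubled-target n))
    (Bound.weighted-count-bound G {n ℕ.* n} |H|≡2n²+1 2≤2n |T|≡2n′ T-sym T-square)
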